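{- Let $m\ge 0$ and $n\ge 0$ be integers. Then, as polynomials in $x$, $$H_{n,m+1}(x)=\sum_{T\in\mathcal{T}_{m+1}(n)}\ \prod_{v\in\mathcal{I}(T)}\frac{(mh_v+1)x+1-h_v}{(m+1)h_v}=\frac{1}{mn+1}\binom{(mn+1)x}{n},$$ where $\binom{y}{n}=y(y-1)\cdots(y-n+1)/n!$.
   Context: All trees are plane trees (rooted, children of each vertex linearly ordered, vertices unlabelled). A complete $p$-ary tree is a plane tree in which every non-leaf (internal) vertex has exactly $p$ children; $\mathcal{T}_p(n)$ denotes the set of complete $p$-ary trees with $n$ internal vertices, the unique such tree with $0$ internal vertices being a single vertex. $\mathcal{I}(T)$ is the set of internal vertices of $T$. For $v\in\mathcal{I}(T)$, the hook length $h_v$ is the number of internal vertices of the subtree of $T$ rooted at $v$ (including $v$). The empty product is $1$, so $H_{0,m+1}(x)=1$. -}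

module Defs where

open import Data.Nat as ℕ using (ℕ; zero; suc)
open import Data.Nat.Properties using (m*n≢0; _!≢0)
open import Data.Integer as ℤ using (ℤ; +_)
open import Data.Rational using (ℚ; _+_; _*_; _-_; _/_; 0ℚ; 1ℚ)
open import Data.List using (List; []; _∷_; _++_; map; foldr)
open import Data.Vec using (Vec; toList)
import Data.Vec as Vec

data PTree (p : ℕ) : Set where
  leaf : PTree p
  node : Vec (PTree p) p → PTree p

internals : ∀ {p} → PTree p → ℕ
internalsV : ∀ {p k} → Vec (PTree p) k → ℕ
internals leaf = 0
internals (node cs) = suc (internalsV cs)
internalsV Vec.[] = 0
internalsV (t Vec.∷ ts) = internals t ℕ.+ internalsV ts

hooks : ∀ {p} → PTree p → List ℕ
hooksV : ∀ {p k} → Vec (PTree p) k → List ℕ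
hooks leaf = []
hooks (node cs) = internals (node cs) ∷ hooksV cs
hooksV Vec.[] = []
hooksV (t Vec.∷ ts) = hooks t ++ hooksV ts

sumℚ : List ℚ → ℚ
sumℚ = foldr _+_ 0ℚ

productℚ : List ℚ → ℚ
productℚ = foldr _*_ 1ℚ

ℕ→ℚ : ℕ → ℚ
ℕ→ℚ k = (+ k) / 1

-- the factor ((m h + 1) x + 1 - h) / ((m+1) h) for a hook length h.
-- Hook lengths are always ≥ 1; the value at h = 0 is never used.
hookFactor : ℕ → ℚ → ℕ → ℚ
hookFactor m x zero = 1ℚ
hookFactor m x (suc k) =
  ((ℕ→ℚ (m ℕ.* suc k ℕ.+ 1) * x + 1ℚ - ℕ→ℚ (suc k))
    * ((+ 1) / (suc m ℕ.* suc k)) {{m*n≢0 (suc m) (suc k)}})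

treeWeight : (m : ℕ) → ℚ → PTree (suc m) → ℚ
treeWeight m x T = productℚ (map (hookFactor m x) (hooks T))

falling : ℚ → ℕ → ℚ
falling y zero = 1ℚ
falling y (suc k) = falling y k * (y - ℕ→ℚ k)

binom : ℚ → ℕ → ℚ
binom y n = falling y n * ((+ 1) / (n ℕ.!)) {{n !≢0}}

-- Let S n be the sum of the weights of the trees with n internal vertices and F k n the sum of the
-- products of the weights of k trees with n internal vertices in total. Splitting off the root,
-- S (n + 1) = h (n + 1) · F (m + 1) n with h the hook factor, and splitting off the first tree shows
-- that F k is the k-fold convolution power of S. With b = m x let
--   A n a = a / (a + b n) · binom (a + b n) n.
-- Rothe's identity  Σ_{i + j = n} A i a · A j c = A n (a + c)  holds for natural c by induction on c,
-- using A (n + 1) c = A (n + 1) (c - 1) + A n (c + b - 1), hence for all c because both sides are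
-- polynomials in c. It gives F k n = A n (k x) once S j = A j x for all j ≤ n, and since
-- h (n + 1) · A n ((m + 1) x) = A (n + 1) x, strong induction yields S n = A n x,
-- which is binom ((m n + 1) x) n / (m n + 1).

module Submission where

open import Data.Nat as ℕ using (ℕ; zero; suc; _≤_; z≤n; s≤s)
import Data.Nat.Properties as ℕₚ
open import Data.Integer as ℤ using (+_)
import Data.Integer.Properties as ℤₚ
open import Data.Product using (Σ-syntax; _×_; _,_)
open import Data.Sum using (inj₁; inj₂)
open import Data.Empty using (⊥; ⊥-elim)
open import Data.Rational using (ℚ; _+_; _*_; _-_; _/_; 0ℚ; 1ℚ; toℚᵘ)
open import Data.Rational.Properties
  using ( toℚᵘ-injective; toℚᵘ-fromℚᵘ; toℚᵘ-homo-+; toℚᵘ-homo-*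
        ; +-identityˡ; +-identityʳ; +-inverseʳ; +-assoc; *-identityˡ; *-identityʳ; *-assoc
        ; *-zeroˡ; *-zeroʳ; *-distribˡ-+; *-distribʳ-+; +-0-isCommutativeMonoid)
open import Data.Rational.Solver renaming (module +-*-Solver to ℚ-Solver)
import Data.Rational.Unnormalised as ℚᵘ
import Data.Rational.Unnormalised.Properties as ℚᵘₚ
open import Data.Vec as Vec using (Vec; []; _∷_; take; drop)
open import Data.Vec.Properties using (∷-injective; ++-injective; take++drop≡id)
open import Data.List as List using (List; []; _∷_; map; [_]; cartesianProductWith)
import Data.List.Properties as List
open import Data.List.Relation.Unary.Any using (here)
open import Data.List.Relation.Unary.All as All using (All; []; _∷_)
import Data.List.Relation.Unary.All.Properties as All
open import Data.List.Relation.Unary.AllPairs using ([]; _∷_)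
open import Data.List.Membership.Propositional using (_∈_)
open import Data.List.Membership.Propositional.Properties
  using (∈-++⁺ˡ; ∈-++⁺ʳ; ∈-map⁺; ∈-map⁻; ∈-cartesianProductWith⁺)
open import Data.List.Membership.Propositional.Properties.WithK using (unique∧set⇒bag)
open import Data.List.Relation.Unary.Unique.Propositional using (Unique)
import Data.List.Relation.Unary.Unique.Propositional.Properties as Unique
open import Data.List.Relation.Binary.Permutation.Propositional using (_↭_; ↭⇒↭ₛ)
import Data.List.Relation.Binary.Permutation.Propositional.Properties as ↭
open import Data.List.Relation.Binary.BagAndSetEquality using (∼bag⇒↭)
open import Function using (_∘_)
open import Function.Bundles using (_⇔_; mk⇔; Equivalence)
open import Relation.Binary.PropositionalEquality hiding ([_])
open import Data.List.Relation.Binary.Permutation.Setoid.Properties (setoid ℚ) using (foldr-commMonoid)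
open import Defs

open ℚ-Solver

ℕ→ℚ-suc : ∀ k → ℕ→ℚ (suc k) ≡ 1ℚ + ℕ→ℚ k
ℕ→ℚ-suc k = toℚᵘ-injective (begin
  toℚᵘ (ℕ→ℚ (suc k))                      ≈⟨ toℚᵘ-fromℚᵘ _ ⟩
  ℚᵘ.mkℚᵘ (+ suc k) 0                      ≈⟨ ℚᵘ.*≡* (cong (ℤ._* + 1) (cong (ℤ._+_ (+ 1)) (sym (ℤₚ.*-identityʳ (+ k))))) ⟩
  ℚᵘ.1ℚᵘ ℚᵘ.+ ℚᵘ.mkℚᵘ (+ k) 0            ≈⟨ ℚᵘₚ.+-congʳ ℚᵘ.1ℚᵘ (ℚᵘₚ.≃-sym (toℚᵘ-fromℚᵘ (ℚᵘ.mkℚᵘ (+ k) 0))) ⟩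
  toℚᵘ 1ℚ ℚᵘ.+ toℚᵘ (ℕ→ℚ k)              ≈⟨ ℚᵘₚ.≃-sym (toℚᵘ-homo-+ 1ℚ (ℕ→ℚ k)) ⟩
  toℚᵘ (1ℚ + ℕ→ℚ k)                       ∎)
  where open ℚᵘₚ.≃-Reasoning

ℕ→ℚ-+ : ∀ a b → ℕ→ℚ (a ℕ.+ b) ≡ ℕ→ℚ a + ℕ→ℚ b
ℕ→ℚ-+ zero    b = sym (+-identityˡ (ℕ→ℚ b))
ℕ→ℚ-+ (suc a) b = begin
  ℕ→ℚ (suc (a ℕ.+ b))          ≡⟨ ℕ→ℚ-suc (a ℕ.+ b) ⟩
  1ℚ + ℕ→ℚ (a ℕ.+ b)           ≡⟨ cong (_+_ 1ℚ) (ℕ→ℚ-+ a b) ⟩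
  1ℚ + (ℕ→ℚ a + ℕ→ℚ b)         ≡⟨ +-assoc 1ℚ (ℕ→ℚ a) (ℕ→ℚ b) ⟨
  (1ℚ + ℕ→ℚ a) + ℕ→ℚ b         ≡⟨ cong (_+ ℕ→ℚ b) (ℕ→ℚ-suc a) ⟨
  ℕ→ℚ (suc a) + ℕ→ℚ b          ∎
  where open ≡-Reasoning

ℕ→ℚ-* : ∀ a b → ℕ→ℚ (a ℕ.* b) ≡ ℕ→ℚ a * ℕ→ℚ b
ℕ→ℚ-* zero    b = sym (*-zeroˡ (ℕ→ℚ b))
ℕ→ℚ-* (suc a) b = begin
  ℕ→ℚ (b ℕ.+ a ℕ.* b)          ≡⟨ ℕ→ℚ-+ b (a ℕ.* b) ⟩
  ℕ→ℚ b + ℕ→ℚ (a ℕ.* b)        ≡⟨ cong (_+_ (ℕ→ℚ b)) (ℕ→ℚ-* a b) ⟩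
  ℕ→ℚ b + ℕ→ℚ a * ℕ→ℚ b        ≡⟨ solve 2 (λ x y → y :+ x :* y := (con 1ℚ :+ x) :* y) refl (ℕ→ℚ a) (ℕ→ℚ b) ⟩
  (1ℚ + ℕ→ℚ a) * ℕ→ℚ b         ≡⟨ cong (_* ℕ→ℚ b) (ℕ→ℚ-suc a) ⟨
  ℕ→ℚ (suc a) * ℕ→ℚ b          ∎
  where open ≡-Reasoning

1/ℕ : (n : ℕ) → .{{ℕ.NonZero n}} → ℚ
1/ℕ n = + 1 / n

ℕ→ℚ*1/ℕ : ∀ n .{{_ : ℕ.NonZero n}} → ℕ→ℚ n * 1/ℕ n ≡ 1ℚ
ℕ→ℚ*1/ℕ (suc n) = toℚᵘ-injective (begin
  toℚᵘ (ℕ→ℚ (suc n) * 1/ℕ (suc n))                   ≈⟨ toℚᵘ-homo-* (ℕ→ℚ (suc n)) (1/ℕ (suc n)) ⟩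
  toℚᵘ (ℕ→ℚ (suc n)) ℚᵘ.* toℚᵘ (1/ℕ (suc n))         ≈⟨ ℚᵘₚ.*-cong (toℚᵘ-fromℚᵘ (ℚᵘ.mkℚᵘ (+ suc n) 0)) (toℚᵘ-fromℚᵘ (ℚᵘ.mkℚᵘ (+ 1) n)) ⟩
  ℚᵘ.mkℚᵘ (+ suc n) 0 ℚᵘ.* ℚᵘ.mkℚᵘ (+ 1) n            ≈⟨ ℚᵘₚ.*-inverseʳ (ℚᵘ.mkℚᵘ (+ suc n) 0) ⟩
  ℚᵘ.1ℚᵘ                                              ∎)
  where open ℚᵘₚ.≃-Reasoning

1/ℕ-* : ∀ a b .{{_ : ℕ.NonZero a}} .{{_ : ℕ.NonZero b}} →
        1/ℕ (a ℕ.* b) {{ℕₚ.m*n≢0 a b}} ≡ 1/ℕ a * 1/ℕ b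
1/ℕ-* (suc a) (suc b) = toℚᵘ-injective (begin
  toℚᵘ (1/ℕ (suc a ℕ.* suc b))                        ≈⟨ toℚᵘ-fromℚᵘ (ℚᵘ.mkℚᵘ (+ 1) (b ℕ.+ a ℕ.* suc b)) ⟩
  ℚᵘ.mkℚᵘ (+ 1) a ℚᵘ.* ℚᵘ.mkℚᵘ (+ 1) b                ≈⟨ ℚᵘₚ.*-cong (toℚᵘ-fromℚᵘ (ℚᵘ.mkℚᵘ (+ 1) a)) (toℚᵘ-fromℚᵘ (ℚᵘ.mkℚᵘ (+ 1) b)) ⟨
  toℚᵘ (1/ℕ (suc a)) ℚᵘ.* toℚᵘ (1/ℕ (suc b))          ≈⟨ toℚᵘ-homo-* (1/ℕ (suc a)) (1/ℕ (suc b)) ⟨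
  toℚᵘ (1/ℕ (suc a) * 1/ℕ (suc b))                    ∎)
  where open ℚᵘₚ.≃-Reasoning

ℕ→ℚ*≡0⇒≡0 : ∀ n .{{_ : ℕ.NonZero n}} {q} → ℕ→ℚ n * q ≡ 0ℚ → q ≡ 0ℚ
ℕ→ℚ*≡0⇒≡0 n {q} nq≡0 = begin
  q                           ≡⟨ *-identityˡ q ⟨
  1ℚ * q                      ≡⟨ cong (_* q) (ℕ→ℚ*1/ℕ n) ⟨
  ℕ→ℚ n * 1/ℕ n * q           ≡⟨ solve 3 (λ a b q → a :* b :* q := b :* (a :* q)) refl (ℕ→ℚ n) (1/ℕ n) q ⟩
  1/ℕ n * (ℕ→ℚ n * q)         ≡⟨ cong (1/ℕ n *_) nq≡0 ⟩
  1/ℕ n * 0ℚ                  ≡⟨ *-zeroʳ (1/ℕ n) ⟩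
  0ℚ                          ∎
  where open ≡-Reasoning

p-q≡0⇒p≡q : ∀ {p q} → p - q ≡ 0ℚ → p ≡ q
p-q≡0⇒p≡q {p} {q} p-q≡0 = begin
  p             ≡⟨ solve 2 (λ p q → p := (p :- q) :+ q) refl p q ⟩
  (p - q) + q   ≡⟨ cong (_+ q) p-q≡0 ⟩
  0ℚ + q        ≡⟨ +-identityˡ q ⟩
  q             ∎
  where open ≡-Reasoning

-- Polynomial functions of degree at most d, in Horner form f x = f 0 + x · g x.
IsPolynomial : ℕ → (ℚ → ℚ) → Set
IsPolynomial zero    f = ∀ x → f x ≡ f 0ℚ
IsPolynomial (suc d) f = Σ[ g ∈ (ℚ → ℚ) ] IsPolynomial d g × (∀ x → f x ≡ f 0ℚ + x * g x)

isPolynomial-resp-≗ : ∀ d {f g} → f ≗ g → IsPolynomial d f → IsPolynomial d g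
isPolynomial-resp-≗ zero    f≗g p x = trans (sym (f≗g x)) (trans (p x) (f≗g 0ℚ))
isPolynomial-resp-≗ (suc d) f≗g (h , ph , eq) =
  h , ph , λ x → trans (sym (f≗g x)) (trans (eq x) (cong (_+ x * h x) (f≗g 0ℚ)))

isPolynomial-const : ∀ d c → IsPolynomial d (λ _ → c)
isPolynomial-const zero    c x = refl
isPolynomial-const (suc d) c =
  (λ _ → 0ℚ) , isPolynomial-const d 0ℚ , λ x → solve 2 (λ c x → c := c :+ x :* con 0ℚ) refl c x

isPolynomial-≤ : ∀ {d e f} → d ≤ e → IsPolynomial d f → IsPolynomial e f
isPolynomial-≤ {e = zero}      z≤n p = p
isPolynomial-≤ {e = suc e} {f} z≤n p =
  (λ _ → 0ℚ) , isPolynomial-const e 0ℚ ,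
  λ x → trans (p x) (solve 2 (λ c x → c := c :+ x :* con 0ℚ) refl (f 0ℚ) x)
isPolynomial-≤ (s≤s d≤e) (g , pg , eq) = g , isPolynomial-≤ d≤e pg , eq

isPolynomial-+ : ∀ d {f g} → IsPolynomial d f → IsPolynomial d g → IsPolynomial d (λ x → f x + g x)
isPolynomial-+ zero    pf pg x = cong₂ _+_ (pf x) (pg x)
isPolynomial-+ (suc d) {f} {g} (f′ , pf′ , eqf) (g′ , pg′ , eqg) =
  (λ x → f′ x + g′ x) , isPolynomial-+ d pf′ pg′ ,
  λ x → trans (cong₂ _+_ (eqf x) (eqg x))
    (solve 5 (λ a b x u v → (a :+ x :* u) :+ (b :+ x :* v) := (a :+ b) :+ x :* (u :+ v))
           refl (f 0ℚ) (g 0ℚ) x (f′ x) (g′ x))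

isPolynomial-difference : ∀ d {f g} → IsPolynomial d f → IsPolynomial d g → IsPolynomial d (λ x → f x - g x)
isPolynomial-difference zero    pf pg x = cong₂ _-_ (pf x) (pg x)
isPolynomial-difference (suc d) {f} {g} (f′ , pf′ , eqf) (g′ , pg′ , eqg) =
  (λ x → f′ x - g′ x) , isPolynomial-difference d pf′ pg′ ,
  λ x → trans (cong₂ _-_ (eqf x) (eqg x))
    (solve 5 (λ a b x u v → (a :+ x :* u) :- (b :+ x :* v) := (a :- b) :+ x :* (u :- v))
           refl (f 0ℚ) (g 0ℚ) x (f′ x) (g′ x))

isPolynomial-*ˡ : ∀ d c {f} → IsPolynomial d f → IsPolynomial d (λ x → c * f x)
isPolynomial-*ˡ zero    c pf x = cong (c *_) (pf x)
isPolynomial-*ˡ (suc d) c {f} (g , pg , eq) =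
  (λ x → c * g x) , isPolynomial-*ˡ d c pg ,
  λ x → trans (cong (c *_) (eq x))
    (solve 4 (λ c a x u → c :* (a :+ x :* u) := c :* a :+ x :* (c :* u)) refl c (f 0ℚ) x (g x))

isPolynomial-linear* : ∀ d e {f} → IsPolynomial d f → IsPolynomial (suc d) (λ x → (x + e) * f x)
isPolynomial-linear* d e {f} pf =
  isPolynomial-resp-≗ (suc d) (λ x → solve 3 (λ x e a → x :* a :+ e :* a := (x :+ e) :* a) refl x e (f x))
    (isPolynomial-+ (suc d) x*f (isPolynomial-≤ (ℕₚ.n≤1+n d) (isPolynomial-*ˡ d e pf)))
  where
  x*f : IsPolynomial (suc d) (λ x → x * f x)
  x*f = f , pf , λ x → sym (trans (cong (_+ x * f x) (*-zeroˡ (f 0ℚ))) (+-identityˡ (x * f x)))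

polynomial-remainder : ∀ d {f} → IsPolynomial (suc d) f → ∀ r →
  Σ[ h ∈ (ℚ → ℚ) ] IsPolynomial d h × (∀ x → f x ≡ f r + (x - r) * h x)
polynomial-remainder zero {f} (g , pg , eq) r = (λ _ → g 0ℚ) , (λ _ → refl) , λ x → begin
  f x                                  ≡⟨ eq x ⟩
  f 0ℚ + x * g x                       ≡⟨ cong (λ t → f 0ℚ + x * t) (pg x) ⟩
  f 0ℚ + x * g 0ℚ                      ≡⟨ solve 4 (λ a x r c → a :+ x :* c := (a :+ r :* c) :+ (x :- r) :* c) refl (f 0ℚ) x r (g 0ℚ) ⟩
  (f 0ℚ + r * g 0ℚ) + (x - r) * g 0ℚ   ≡⟨ cong (λ t → f 0ℚ + r * t + (x - r) * g 0ℚ) (pg r) ⟨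
  (f 0ℚ + r * g r) + (x - r) * g 0ℚ    ≡⟨ cong (_+ (x - r) * g 0ℚ) (eq r) ⟨
  f r + (x - r) * g 0ℚ                 ∎
  where open ≡-Reasoning
polynomial-remainder (suc d) {f} (g , pg , eq) r with polynomial-remainder d pg r
... | h , ph , eqg = (λ x → g r + x * h x) , (h , ph , λ x → cong (_+ x * h x) (sym constant-term)) , λ x → begin
  f x                                           ≡⟨ eq x ⟩
  f 0ℚ + x * g x                                ≡⟨ cong (λ t → f 0ℚ + x * t) (eqg x) ⟩
  f 0ℚ + x * (g r + (x - r) * h x)              ≡⟨ solve 5 (λ a c x r u → a :+ x :* (c :+ (x :- r) :* u) := (a :+ r :* c) :+ (x :- r) :* (c :+ x :* u)) refl (f 0ℚ) (g r) x r (h x) ⟩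
  (f 0ℚ + r * g r) + (x - r) * (g r + x * h x)  ≡⟨ cong (_+ (x - r) * (g r + x * h x)) (eq r) ⟨
  f r + (x - r) * (g r + x * h x)               ∎
  where
  open ≡-Reasoning
  constant-term : g r + 0ℚ * h 0ℚ ≡ g r
  constant-term = trans (cong (_+_ (g r)) (*-zeroˡ (h 0ℚ))) (+-identityʳ (g r))

polynomial-vanishing : ∀ d {f} → IsPolynomial d f → ∀ s →
  (∀ i → f (ℕ→ℚ (s ℕ.+ i)) ≡ 0ℚ) → ∀ x → f x ≡ 0ℚ
polynomial-vanishing zero    {f} pf s f≡0 x = trans (pf x) (trans (sym (pf (ℕ→ℚ (s ℕ.+ 0)))) (f≡0 0))
polynomial-vanishing (suc d) {f} pf s f≡0 x with polynomial-remainder d pf (ℕ→ℚ s)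
... | h , ph , eq = begin
  f x                  ≡⟨ eq x ⟩
  f r + (x - r) * h x  ≡⟨ cong₂ (λ a b → a + (x - r) * b) fr≡0 (h≡0 x) ⟩
  0ℚ + (x - r) * 0ℚ    ≡⟨ trans (+-identityˡ _) (*-zeroʳ (x - r)) ⟩
  0ℚ                   ∎
  where
  open ≡-Reasoning
  r = ℕ→ℚ s
  fr≡0 : f r ≡ 0ℚ
  fr≡0 = trans (cong (f ∘ ℕ→ℚ) (sym (ℕₚ.+-identityʳ s))) (f≡0 0)
  slope : ∀ y → (y - r) * h y ≡ f y - f r
  slope y = sym (trans (cong (_- f r) (eq y)) (solve 2 (λ a b → (a :+ b) :- a := b) refl (f r) ((y - r) * h y)))
  h-vanishes : ∀ i → ℕ→ℚ (suc i) * h (ℕ→ℚ (suc s ℕ.+ i)) ≡ 0ℚ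
  h-vanishes i = begin
    ℕ→ℚ (suc i) * h (ℕ→ℚ (suc s ℕ.+ i))         ≡⟨ cong₂ (λ a b → a * h (ℕ→ℚ b)) distance (ℕₚ.+-suc s i) ⟨
    (ℕ→ℚ (s ℕ.+ suc i) - r) * h (ℕ→ℚ (s ℕ.+ suc i)) ≡⟨ slope (ℕ→ℚ (s ℕ.+ suc i)) ⟩
    f (ℕ→ℚ (s ℕ.+ suc i)) - f r                   ≡⟨ cong₂ _-_ (f≡0 (suc i)) fr≡0 ⟩
    0ℚ - 0ℚ                                       ≡⟨⟩
    0ℚ                                            ∎
    where
    distance : ℕ→ℚ (s ℕ.+ suc i) - r ≡ ℕ→ℚ (suc i)
    distance = trans (cong (_- r) (ℕ→ℚ-+ s (suc i))) (solve 2 (λ r a → (r :+ a) :- r := a) refl r (ℕ→ℚ (suc i)))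
  h≡0 : ∀ y → h y ≡ 0ℚ
  h≡0 = polynomial-vanishing d ph (suc s) (λ i → ℕ→ℚ*≡0⇒≡0 (suc i) (h-vanishes i))

polynomial-ext-ℕ : ∀ d {f g} → IsPolynomial d f → IsPolynomial d g →
  (∀ i → f (ℕ→ℚ i) ≡ g (ℕ→ℚ i)) → f ≗ g
polynomial-ext-ℕ d {f} {g} pf pg f≡g x =
  p-q≡0⇒p≡q (polynomial-vanishing d (isPolynomial-difference d pf pg) 0 (λ i → trans (cong₂ _-_ (f≡g i) refl) (+-inverseʳ (g (ℕ→ℚ i)))) x)

-- Rothe polynomials

1/fact : ℕ → ℚ
1/fact n = 1/ℕ (n ℕ.!) {{n ℕₚ.!≢0}}

1/fact-suc : ∀ n → 1/fact (suc n) ≡ 1/ℕ (suc n) * 1/fact n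
1/fact-suc n = 1/ℕ-* (suc n) (n ℕ.!) {{_}} {{n ℕₚ.!≢0}}

ℕ→ℚ*1/fact : ∀ n → ℕ→ℚ (suc n) * 1/fact (suc n) ≡ 1/fact n
ℕ→ℚ*1/fact n = begin
  ℕ→ℚ (suc n) * 1/fact (suc n)              ≡⟨ cong (ℕ→ℚ (suc n) *_) (1/fact-suc n) ⟩
  ℕ→ℚ (suc n) * (1/ℕ (suc n) * 1/fact n)    ≡⟨ *-assoc (ℕ→ℚ (suc n)) (1/ℕ (suc n)) (1/fact n) ⟨
  ℕ→ℚ (suc n) * 1/ℕ (suc n) * 1/fact n      ≡⟨ cong (_* 1/fact n) (ℕ→ℚ*1/ℕ (suc n)) ⟩
  1ℚ * 1/fact n                             ≡⟨ *-identityˡ (1/fact n) ⟩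
  1/fact n                                  ∎
  where open ≡-Reasoning

falling-sucˡ : ∀ y k → falling y (suc k) ≡ y * falling (y - 1ℚ) k
falling-sucˡ y zero    = solve 1 (λ y → con 1ℚ :* (y :- con 0ℚ) := y :* con 1ℚ) refl y
falling-sucˡ y (suc k) = begin
  falling y (suc k) * (y - ℕ→ℚ (suc k))                  ≡⟨ cong₂ (λ a b → a * (y - b)) (falling-sucˡ y k) (ℕ→ℚ-suc k) ⟩
  y * falling (y - 1ℚ) k * (y - (1ℚ + ℕ→ℚ k))            ≡⟨ solve 3 (λ y F K → y :* F :* (y :- (con 1ℚ :+ K)) := y :* (F :* ((y :- con 1ℚ) :- K))) refl y (falling (y - 1ℚ) k) (ℕ→ℚ k) ⟩
  y * (falling (y - 1ℚ) k * ((y - 1ℚ) - ℕ→ℚ k))          ∎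
  where open ≡-Reasoning

isPolynomial-falling : ∀ k e → IsPolynomial k (λ c → falling (c + e) k)
isPolynomial-falling zero    e = isPolynomial-const 0 1ℚ
isPolynomial-falling (suc k) e =
  isPolynomial-resp-≗ (suc k) (λ c → solve 4 (λ c e K F → (c :+ (e :- K)) :* F := F :* ((c :+ e) :- K)) refl c e (ℕ→ℚ k) (falling (c + e) k))
    (isPolynomial-linear* k (e - ℕ→ℚ k) (isPolynomial-falling k e))

-- The A n a of the header, a / (a + b n) · binom (a + b n) n, with the division carried out.
Rothe : ℚ → ℕ → ℚ → ℚ
Rothe b zero    a = 1ℚ
Rothe b (suc n) a = a * falling (a + b * ℕ→ℚ (suc n) - 1ℚ) n * 1/fact (suc n)

isPolynomial-Rothe : ∀ b n e → IsPolynomial n (λ c → Rothe b n (e + c))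
isPolynomial-Rothe b zero    e = isPolynomial-const 0 1ℚ
isPolynomial-Rothe b (suc n) e =
  isPolynomial-resp-≗ (suc n) reassociate
    (isPolynomial-*ˡ (suc n) (1/fact (suc n)) (isPolynomial-linear* n e (isPolynomial-falling n e′)))
  where
  e′ = e + b * ℕ→ℚ (suc n) - 1ℚ
  reassociate : ∀ c → 1/fact (suc n) * ((c + e) * falling (c + e′) n) ≡ Rothe b (suc n) (e + c)
  reassociate c = begin
    1/fact (suc n) * ((c + e) * falling (c + e′) n)
      ≡⟨ cong (λ t → 1/fact (suc n) * ((c + e) * falling t n)) (solve 4 (λ c e b N → c :+ (e :+ b :* N :- con 1ℚ) := (e :+ c) :+ b :* N :- con 1ℚ) refl c e b (ℕ→ℚ (suc n))) ⟩
    1/fact (suc n) * ((c + e) * falling ((e + c) + b * ℕ→ℚ (suc n) - 1ℚ) n)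
      ≡⟨ solve 4 (λ I c e F → I :* ((c :+ e) :* F) := (e :+ c) :* F :* I) refl (1/fact (suc n)) c e (falling ((e + c) + b * ℕ→ℚ (suc n) - 1ℚ) n) ⟩
    Rothe b (suc n) (e + c) ∎
    where open ≡-Reasoning

-- The coefficient identity behind Pascal's rule, with N = k + 2 and y = c + b N - 1.
pascal-identity : ∀ b c K G F N → N ≡ 1ℚ + (1ℚ + K) →
  c * ((c + b * N - 1ℚ) * G) * F
    ≡ (c - 1ℚ) * (G * (c + b * N - 1ℚ - 1ℚ - K)) * F + (c + b - 1ℚ) * G * (N * F)
pascal-identity b c K G F _ refl =
  solve 5 (λ b c K G F →
    c :* ((c :+ b :* (con 1ℚ :+ (con 1ℚ :+ K)) :- con 1ℚ) :* G) :* F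
      := (c :- con 1ℚ) :* (G :* (c :+ b :* (con 1ℚ :+ (con 1ℚ :+ K)) :- con 1ℚ :- con 1ℚ :- K)) :* F
         :+ (c :+ b :- con 1ℚ) :* G :* ((con 1ℚ :+ (con 1ℚ :+ K)) :* F)) refl b c K G F

Rothe-pascal : ∀ b n c → Rothe b (suc n) c ≡ Rothe b (suc n) (c - 1ℚ) + Rothe b n (c + b - 1ℚ)
Rothe-pascal b zero    c =
  solve 1 (λ c → c :* con 1ℚ :* con 1ℚ := (c :- con 1ℚ) :* con 1ℚ :* con 1ℚ :+ con 1ℚ) refl c
Rothe-pascal b (suc k) c = begin
  c * falling y (suc k) * F
    ≡⟨ cong (λ t → c * t * F) (falling-sucˡ y k) ⟩
  c * (y * G) * F
    ≡⟨ pascal-identity b c K G F N N≡2+K ⟩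
  (c - 1ℚ) * (G * (y - 1ℚ - K)) * F + (c + b - 1ℚ) * G * (N * F)
    ≡⟨ cong₂ _+_ (cong (λ z → (c - 1ℚ) * falling z (suc k) * F) shift₁)
                 (cong₂ (λ z u → (c + b - 1ℚ) * falling z k * u) shift₂ (sym (ℕ→ℚ*1/fact (suc k)))) ⟨
  Rothe b (suc (suc k)) (c - 1ℚ) + Rothe b (suc k) (c + b - 1ℚ)
    ∎
  where
  open ≡-Reasoning
  K = ℕ→ℚ k
  N = ℕ→ℚ (suc (suc k))
  y = c + b * N - 1ℚ
  G = falling (y - 1ℚ) k
  F = 1/fact (suc (suc k))
  N≡1+N₁ : N ≡ 1ℚ + ℕ→ℚ (suc k)
  N≡1+N₁ = ℕ→ℚ-suc (suc k)
  N≡2+K : N ≡ 1ℚ + (1ℚ + K)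
  N≡2+K = trans N≡1+N₁ (cong (_+_ 1ℚ) (ℕ→ℚ-suc k))
  shift₁ : (c - 1ℚ) + b * N - 1ℚ ≡ y - 1ℚ
  shift₁ = solve 3 (λ c b N → (c :- con 1ℚ) :+ b :* N :- con 1ℚ := (c :+ b :* N :- con 1ℚ) :- con 1ℚ) refl c b N
  shift₂ : (c + b - 1ℚ) + b * ℕ→ℚ (suc k) - 1ℚ ≡ y - 1ℚ
  shift₂ = trans (solve 3 (λ c b M → (c :+ b :- con 1ℚ) :+ b :* M :- con 1ℚ := (c :+ b :* (con 1ℚ :+ M) :- con 1ℚ) :- con 1ℚ) refl c b (ℕ→ℚ (suc k)))
                 (cong (λ t → c + b * t - 1ℚ - 1ℚ) (sym N≡1+N₁))

Rothe-at-0 : ∀ b n → Rothe b (suc n) 0ℚ ≡ 0ℚ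
Rothe-at-0 b n = trans (cong (_* 1/fact (suc n)) (*-zeroˡ (falling (0ℚ + b * ℕ→ℚ (suc n) - 1ℚ) n))) (*-zeroˡ (1/fact (suc n)))

conv : (ℕ → ℚ) → (ℕ → ℚ) → ℕ → ℚ
conv u v zero    = u 0 * v 0
conv u v (suc n) = u 0 * v (suc n) + conv (u ∘ suc) v n

conv-sucʳ : ∀ u v n → conv u v (suc n) ≡ conv u (v ∘ suc) n + u (suc n) * v 0
conv-sucʳ u v zero    = refl
conv-sucʳ u v (suc n) = trans (cong (_+_ (u 0 * v (suc (suc n)))) (conv-sucʳ (u ∘ suc) v n))
  (solve 3 (λ a b c → a :+ (b :+ c) := (a :+ b) :+ c) refl (u 0 * v (suc (suc n))) (conv (u ∘ suc) (v ∘ suc) n) (u (suc (suc n)) * v 0))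

conv-cong : ∀ n {u u′ v v′} → (∀ j → j ≤ n → u j ≡ u′ j) → (∀ j → j ≤ n → v j ≡ v′ j) → conv u v n ≡ conv u′ v′ n
conv-cong zero    u≡ v≡ = cong₂ _*_ (u≡ 0 z≤n) (v≡ 0 z≤n)
conv-cong (suc n) u≡ v≡ = cong₂ _+_ (cong₂ _*_ (u≡ 0 z≤n) (v≡ (suc n) ℕₚ.≤-refl))
  (conv-cong n (λ j j≤n → u≡ (suc j) (s≤s j≤n)) (λ j j≤n → v≡ j (ℕₚ.m≤n⇒m≤1+n j≤n)))

conv-distribˡ-+ : ∀ n u v w → conv u (λ j → v j + w j) n ≡ conv u v n + conv u w n
conv-distribˡ-+ zero    u v w = *-distribˡ-+ (u 0) (v 0) (w 0)
conv-distribˡ-+ (suc n) u v w = trans (cong₂ _+_ (*-distribˡ-+ (u 0) (v (suc n)) (w (suc n))) (conv-distribˡ-+ n (u ∘ suc) v w))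
  (solve 4 (λ a b c d → (a :+ b) :+ (c :+ d) := (a :+ c) :+ (b :+ d)) refl (u 0 * v (suc n)) (u 0 * w (suc n)) (conv (u ∘ suc) v n) (conv (u ∘ suc) w n))

conv-zeroʳ : ∀ n u → conv u (λ _ → 0ℚ) n ≡ 0ℚ
conv-zeroʳ zero    u = *-zeroʳ (u 0)
conv-zeroʳ (suc n) u = trans (cong₂ _+_ (*-zeroʳ (u 0)) (conv-zeroʳ n (u ∘ suc))) (+-identityˡ 0ℚ)

δ : ℕ → ℚ
δ zero    = 1ℚ
δ (suc _) = 0ℚ

isPolynomial-conv : ∀ d n u (v : ℕ → ℚ → ℚ) → (∀ j → j ≤ n → IsPolynomial d (v j)) →
                    IsPolynomial d (λ c → conv u (λ j → v j c) n)
isPolynomial-conv d zero    u v pv = isPolynomial-*ˡ d (u 0) (pv 0 z≤n)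
isPolynomial-conv d (suc n) u v pv = isPolynomial-+ d (isPolynomial-*ˡ d (u 0) (pv (suc n) ℕₚ.≤-refl))
  (isPolynomial-conv d n (u ∘ suc) v (λ j j≤n → pv j (ℕₚ.m≤n⇒m≤1+n j≤n)))

rothe-convolution : ∀ b n a c → conv (λ j → Rothe b j a) (λ j → Rothe b j c) n ≡ Rothe b n (a + c)
rothe-convolution b zero    a c = refl
rothe-convolution b (suc n) a   = polynomial-ext-ℕ (suc n) lhs-polynomial (isPolynomial-Rothe b (suc n) a) on-ℕ
  where
  open ≡-Reasoning
  u = λ j → Rothe b j a
  lhs : ℚ → ℚ
  lhs c = conv u (λ j → Rothe b j c) (suc n)

  lhs-polynomial : IsPolynomial (suc n) lhs
  lhs-polynomial = isPolynomial-conv (suc n) (suc n) u (Rothe b) λ j j≤n →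
    isPolynomial-≤ j≤n (isPolynomial-resp-≗ j (cong (Rothe b j) ∘ +-identityˡ) (isPolynomial-Rothe b j 0ℚ))

  lhs-0 : lhs 0ℚ ≡ Rothe b (suc n) (a + 0ℚ)
  lhs-0 = begin
    lhs 0ℚ                                           ≡⟨ conv-sucʳ u (λ j → Rothe b j 0ℚ) n ⟩
    conv u (λ j → Rothe b (suc j) 0ℚ) n + u (suc n) * 1ℚ
      ≡⟨ cong₂ _+_ (trans (conv-cong n (λ _ _ → refl) (λ j _ → Rothe-at-0 b j)) (conv-zeroʳ n u))
                   (*-identityʳ (u (suc n))) ⟩
    0ℚ + u (suc n)                                   ≡⟨ +-identityˡ (u (suc n)) ⟩
    u (suc n)                                        ≡⟨ cong (Rothe b (suc n)) (+-identityʳ a) ⟨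
    Rothe b (suc n) (a + 0ℚ)                         ∎

  lhs-step : ∀ c → lhs (c - 1ℚ) ≡ Rothe b (suc n) (a + (c - 1ℚ)) → lhs c ≡ Rothe b (suc n) (a + c)
  lhs-step c hyp = begin
    lhs c
      ≡⟨ conv-sucʳ u (λ j → Rothe b j c) n ⟩
    conv u (λ j → Rothe b (suc j) c) n + W
      ≡⟨ cong (_+ W) (conv-cong n (λ _ _ → refl) (λ j _ → Rothe-pascal b j c)) ⟩
    conv u (λ j → Rothe b (suc j) (c - 1ℚ) + Rothe b j (c + b - 1ℚ)) n + W
      ≡⟨ cong (_+ W) (conv-distribˡ-+ n u (λ j → Rothe b (suc j) (c - 1ℚ)) (λ j → Rothe b j (c + b - 1ℚ))) ⟩
    (S + conv u (λ j → Rothe b j (c + b - 1ℚ)) n) + W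
      ≡⟨ cong (λ t → (S + t) + W) (rothe-convolution b n a (c + b - 1ℚ)) ⟩
    (S + Rothe b n (a + (c + b - 1ℚ))) + W
      ≡⟨ solve 3 (λ S T W → (S :+ T) :+ W := (S :+ W) :+ T) refl S (Rothe b n (a + (c + b - 1ℚ))) W ⟩
    (S + W) + Rothe b n (a + (c + b - 1ℚ))
      ≡⟨ cong₂ _+_ (trans (sym (conv-sucʳ u (λ j → Rothe b j (c - 1ℚ)) n)) hyp) (cong (Rothe b n) reassoc₁) ⟩
    Rothe b (suc n) (a + (c - 1ℚ)) + Rothe b n (a + c + b - 1ℚ)
      ≡⟨ cong (λ t → Rothe b (suc n) t + Rothe b n (a + c + b - 1ℚ)) reassoc₂ ⟩
    Rothe b (suc n) (a + c - 1ℚ) + Rothe b n (a + c + b - 1ℚ)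
      ≡⟨ Rothe-pascal b n (a + c) ⟨
    Rothe b (suc n) (a + c)
      ∎
    where
    W = u (suc n) * 1ℚ
    S = conv u (λ j → Rothe b (suc j) (c - 1ℚ)) n
    reassoc₁ : a + (c + b - 1ℚ) ≡ a + c + b - 1ℚ
    reassoc₁ = solve 3 (λ a c b → a :+ (c :+ b :- con 1ℚ) := a :+ c :+ b :- con 1ℚ) refl a c b
    reassoc₂ : a + (c - 1ℚ) ≡ a + c - 1ℚ
    reassoc₂ = solve 2 (λ a c → a :+ (c :- con 1ℚ) := a :+ c :- con 1ℚ) refl a c

  on-ℕ : ∀ i → lhs (ℕ→ℚ i) ≡ Rothe b (suc n) (a + ℕ→ℚ i)
  on-ℕ zero    = lhs-0
  on-ℕ (suc i) = lhs-step (ℕ→ℚ (suc i)) (subst (λ c → lhs c ≡ Rothe b (suc n) (a + c)) (sym pred-i) (on-ℕ i))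
    where
    pred-i : ℕ→ℚ (suc i) - 1ℚ ≡ ℕ→ℚ i
    pred-i = trans (cong (_- 1ℚ) (ℕ→ℚ-suc i)) (solve 1 (λ k → (con 1ℚ :+ k) :- con 1ℚ := k) refl (ℕ→ℚ i))

sumℚ-map-++ : ∀ {A : Set} (w : A → ℚ) xs ys → sumℚ (map w (xs List.++ ys)) ≡ sumℚ (map w xs) + sumℚ (map w ys)
sumℚ-map-++ w []       ys = sym (+-identityˡ (sumℚ (map w ys)))
sumℚ-map-++ w (z ∷ xs) ys = trans (cong (_+_ (w z)) (sumℚ-map-++ w xs ys)) (sym (+-assoc (w z) (sumℚ (map w xs)) (sumℚ (map w ys))))

sumℚ-map-*ˡ : ∀ {A : Set} c (w : A → ℚ) xs → sumℚ (map (λ z → c * w z) xs) ≡ c * sumℚ (map w xs)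
sumℚ-map-*ˡ c w []       = sym (*-zeroʳ c)
sumℚ-map-*ˡ c w (z ∷ xs) = trans (cong (_+_ (c * w z)) (sumℚ-map-*ˡ c w xs)) (sym (*-distribˡ-+ c (w z) (sumℚ (map w xs))))

productℚ-++ : ∀ xs ys → productℚ (xs List.++ ys) ≡ productℚ xs * productℚ ys
productℚ-++ []       ys = sym (*-identityˡ (productℚ ys))
productℚ-++ (x ∷ xs) ys = trans (cong (x *_) (productℚ-++ xs ys)) (sym (*-assoc x (productℚ xs) (productℚ ys)))

sumℚ-↭ : ∀ {xs ys} → xs ↭ ys → sumℚ xs ≡ sumℚ ys
sumℚ-↭ xs↭ys = foldr-commMonoid +-0-isCommutativeMonoid (↭⇒↭ₛ xs↭ys)

-- Two duplicate-free lists with the same elements are permutations of each other.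
sum-over-enumeration : ∀ {A : Set} (w : A → ℚ) {xs ys} → Unique xs → Unique ys → (∀ {z} → (z ∈ xs) ⇔ (z ∈ ys)) →
                       sumℚ (map w xs) ≡ sumℚ (map w ys)
sum-over-enumeration w xs! ys! xs∼ys = sumℚ-↭ (↭.map⁺ w (∼bag⇒↭ (unique∧set⇒bag xs! ys! xs∼ys)))

-- Enumerating trees and forests

module _ {p : ℕ} where

  internalsV-++ : ∀ {a k} (xs : Vec (PTree p) a) (ys : Vec (PTree p) k) →
                  internalsV (xs Vec.++ ys) ≡ internalsV xs ℕ.+ internalsV ys
  internalsV-++ []       ys = refl
  internalsV-++ (x ∷ xs) ys = trans (cong (internals x ℕ.+_) (internalsV-++ xs ys)) (sym (ℕₚ.+-assoc (internals x) _ _))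

  node-injective : ∀ {cs ds : Vec (PTree p) p} → node cs ≡ node ds → cs ≡ ds
  node-injective refl = refl

  graft : ∀ {k} → Vec (PTree p) (p ℕ.+ k) → Vec (PTree p) (suc k)
  graft v = node (take p v) ∷ drop p v

  graft-++ : ∀ {k} (cs : Vec (PTree p) p) (ts : Vec (PTree p) k) → graft (cs Vec.++ ts) ≡ node cs ∷ ts
  graft-++ cs ts with ++-injective (take p (cs Vec.++ ts)) cs (take++drop≡id p (cs Vec.++ ts))
  ... | take≡cs , drop≡ts = cong₂ (λ c t → node c ∷ t) take≡cs drop≡ts

  graft-injective : ∀ {k} {v w : Vec (PTree p) (p ℕ.+ k)} → graft v ≡ graft w → v ≡ w
  graft-injective {v = v} {w} eq with ∷-injective eq
  ... | take≡ , drop≡ = begin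
    v                              ≡⟨ take++drop≡id p v ⟨
    take p v Vec.++ drop p v       ≡⟨ cong₂ Vec._++_ (node-injective take≡) drop≡ ⟩
    take p w Vec.++ drop p w       ≡⟨ take++drop≡id p w ⟩
    w                              ∎
    where open ≡-Reasoning

  internalsV-graft : ∀ {k} (v : Vec (PTree p) (p ℕ.+ k)) → internalsV (graft v) ≡ suc (internalsV v)
  internalsV-graft v = cong suc (trans (sym (internalsV-++ (take p v) (drop p v))) (cong internalsV (take++drop≡id p v)))

  preorderForests : (k n : ℕ) → List (Vec (PTree p) k)
  preorderForests zero    zero    = [ [] ]
  preorderForests zero    (suc n) = []
  preorderForests (suc k) zero    = map (leaf ∷_) (preorderForests k zero)
  preorderForests (suc k) (suc n) = map (leaf ∷_) (preorderForests k (suc n)) List.++ map graft (preorderForests (p ℕ.+ k) n)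

  leaf∷-injective : ∀ {k} {v w : Vec (PTree p) k} → leaf ∷ v ≡ leaf ∷ w → v ≡ w
  leaf∷-injective refl = refl

  preorderForests-unique : ∀ k n → Unique (preorderForests k n)
  preorderForests-unique zero    zero    = [] ∷ []
  preorderForests-unique zero    (suc n) = []
  preorderForests-unique (suc k) zero    = Unique.map⁺ leaf∷-injective (preorderForests-unique k zero)
  preorderForests-unique (suc k) (suc n) =
    Unique.++⁺ (Unique.map⁺ leaf∷-injective (preorderForests-unique k (suc n)))
               (Unique.map⁺ graft-injective (preorderForests-unique (p ℕ.+ k) n))
               leaf-vs-node
    where
    leaf-vs-node : ∀ {v} → v ∈ map (leaf ∷_) (preorderForests k (suc n)) × v ∈ map graft (preorderForests (p ℕ.+ k) n) → ⊥
    leaf-vs-node (v∈l , v∈g) with ∈-map⁻ (leaf ∷_) v∈l | ∈-map⁻ graft v∈g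
    ... | _ , _ , refl | _ , _ , ()

  preorderForests-sound : ∀ k n → All (λ v → internalsV v ≡ n) (preorderForests k n)
  preorderForests-sound zero    zero    = refl ∷ []
  preorderForests-sound zero    (suc n) = []
  preorderForests-sound (suc k) zero    = All.map⁺ (preorderForests-sound k zero)
  preorderForests-sound (suc k) (suc n) =
    All.++⁺ (All.map⁺ (preorderForests-sound k (suc n)))
            (All.map⁺ (All.map (λ {w} eq → trans (internalsV-graft w) (cong suc eq)) (preorderForests-sound (p ℕ.+ k) n)))

  preorderForests-complete : ∀ k n (v : Vec (PTree p) k) → internalsV v ≡ n → v ∈ preorderForests k n
  preorderForests-complete zero    zero    []               _  = here refl
  preorderForests-complete (suc k) zero    (leaf ∷ ts)      eq = ∈-map⁺ (leaf ∷_) (preorderForests-complete k zero ts eq)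
  preorderForests-complete (suc k) (suc n) (leaf ∷ ts)      eq = ∈-++⁺ˡ (∈-map⁺ (leaf ∷_) (preorderForests-complete k (suc n) ts eq))
  preorderForests-complete (suc k) (suc n) (node cs ∷ ts)   eq =
    ∈-++⁺ʳ (map (leaf ∷_) (preorderForests k (suc n)))
      (subst (_∈ map graft (preorderForests (p ℕ.+ k) n)) (graft-++ cs ts)
        (∈-map⁺ graft (preorderForests-complete (p ℕ.+ k) n (cs Vec.++ ts) (trans (internalsV-++ cs ts) (ℕₚ.suc-injective eq)))))

  trees : ℕ → List (PTree p)
  trees zero    = [ leaf ]
  trees (suc n) = map node (preorderForests p n)

  trees-unique : ∀ n → Unique (trees n)
  trees-unique zero    = [] ∷ []
  trees-unique (suc n) = Unique.map⁺ node-injective (preorderForests-unique p n)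

  trees-sound : ∀ n → All (λ t → internals t ≡ n) (trees n)
  trees-sound zero    = refl ∷ []
  trees-sound (suc n) = All.map⁺ (All.map (cong suc) (preorderForests-sound p n))

  trees-complete : ∀ n t → internals t ≡ n → t ∈ trees n
  trees-complete zero    leaf      _  = here refl
  trees-complete (suc n) (node cs) eq = ∈-map⁺ node (preorderForests-complete p n cs (ℕₚ.suc-injective eq))

  -- The vectors t ∷ f with f ∈ G j, s ≤ internals t and internals t + j = s + n.
  withFirstTree : ∀ {k} → (ℕ → List (Vec (PTree p) k)) → ℕ → ℕ → List (Vec (PTree p) (suc k))
  withFirstTree G s zero    = cartesianProductWith _∷_ (trees s) (G zero)
  withFirstTree G s (suc n) = cartesianProductWith _∷_ (trees s) (G (suc n)) List.++ withFirstTree G (suc s) n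

  -- Lists the same vectors as preorderForests, grouped by the size of the first tree; this makes
  -- forest sums convolutions, whereas preorderForests is what allows trees to be defined structurally.
  forests : (k n : ℕ) → List (Vec (PTree p) k)
  forests zero    zero    = [ [] ]
  forests zero    (suc n) = []
  forests (suc k) n       = withFirstTree (forests k) 0 n

  module _ {k} (G : ℕ → List (Vec (PTree p) k)) where

    products-all : ∀ {P : Vec (PTree p) (suc k) → Set} s j → (∀ {t f} → t ∈ trees s → f ∈ G j → P (t ∷ f)) →
                   All P (cartesianProductWith _∷_ (trees s) (G j))
    products-all s j = All.cartesianProductWith⁺ (setoid _) (setoid _) _∷_ (trees s) (G j)

    products-heads : ∀ s j → All (λ v → internals (Vec.head v) ≡ s) (cartesianProductWith _∷_ (trees s) (G j))
    products-heads s j = products-all s j (λ t∈ _ → All.lookup (trees-sound s) t∈)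

    withFirstTree-heads : ∀ s n → All (λ v → s ≤ internals (Vec.head v)) (withFirstTree G s n)
    withFirstTree-heads s zero    = All.map (ℕₚ.≤-reflexive ∘ sym) (products-heads s zero)
    withFirstTree-heads s (suc n) =
      All.++⁺ (All.map (ℕₚ.≤-reflexive ∘ sym) (products-heads s (suc n)))
              (All.map ℕₚ.<⇒≤ (withFirstTree-heads (suc s) n))

    pair-size : (∀ j → All (λ f → internalsV f ≡ j) (G j)) → ∀ {s j t f} → t ∈ trees s → f ∈ G j → internalsV (t ∷ f) ≡ s ℕ.+ j
    pair-size G-sound {s} {j} t∈ f∈ = cong₂ ℕ._+_ (All.lookup (trees-sound s) t∈) (All.lookup (G-sound j) f∈)

    withFirstTree-sound : (∀ j → All (λ f → internalsV f ≡ j) (G j)) →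
                          ∀ s n → All (λ v → internalsV v ≡ s ℕ.+ n) (withFirstTree G s n)
    withFirstTree-sound G-sound s zero    = products-all s zero (pair-size G-sound)
    withFirstTree-sound G-sound s (suc n) =
      All.++⁺ (products-all s (suc n) (pair-size G-sound))
              (All.map (λ eq → trans eq (sym (ℕₚ.+-suc s n))) (withFirstTree-sound G-sound (suc s) n))

    withFirstTree-complete : (∀ j f → internalsV f ≡ j → f ∈ G j) →
      ∀ s n t f → s ≤ internals t → internals t ℕ.+ internalsV f ≡ s ℕ.+ n → t ∷ f ∈ withFirstTree G s n
    withFirstTree-complete G-complete s n t f s≤t total with ℕₚ.m≤n⇒m<n∨m≡n s≤t
    ... | inj₂ refl = first-block n (∈-cartesianProductWith⁺ _∷_ (trees-complete s t refl)
                                       (G-complete n f (ℕₚ.+-cancelˡ-≡ s _ _ total)))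
      where
      first-block : ∀ n → t ∷ f ∈ cartesianProductWith _∷_ (trees s) (G n) → t ∷ f ∈ withFirstTree G s n
      first-block zero    v∈ = v∈
      first-block (suc n) v∈ = ∈-++⁺ˡ v∈
    withFirstTree-complete G-complete s zero    t f s≤t total | inj₁ s<t =
      ⊥-elim (ℕₚ.<⇒≱ s<t (subst (internals t ≤_) (trans total (ℕₚ.+-identityʳ s)) (ℕₚ.m≤m+n (internals t) (internalsV f))))
    withFirstTree-complete G-complete s (suc n) t f s≤t total | inj₁ s<t =
      ∈-++⁺ʳ (cartesianProductWith _∷_ (trees s) (G (suc n)))
             (withFirstTree-complete G-complete (suc s) n t f s<t (trans total (ℕₚ.+-suc s n)))

    withFirstTree-unique : (∀ j → Unique (G j)) → ∀ s n → Unique (withFirstTree G s n)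
    withFirstTree-unique G-unique s zero    = Unique.cartesianProductWith⁺ _∷_ ∷-injective (trees-unique s) (G-unique zero)
    withFirstTree-unique G-unique s (suc n) =
      Unique.++⁺ (Unique.cartesianProductWith⁺ _∷_ ∷-injective (trees-unique s) (G-unique (suc n)))
                 (withFirstTree-unique G-unique (suc s) n)
                 λ { {t ∷ f} (v∈first , v∈rest) →
                     ℕₚ.<-irrefl (sym (All.lookup (products-heads s (suc n)) v∈first))
                                 (All.lookup (withFirstTree-heads (suc s) n) v∈rest) }

forests-sound : ∀ {p} k n → All (λ v → internalsV v ≡ n) (forests {p} k n)
forests-sound zero    zero    = refl ∷ []
forests-sound zero    (suc n) = []
forests-sound (suc k) n       = withFirstTree-sound (forests k) (forests-sound k) 0 n

forests-complete : ∀ {p} k n (v : Vec (PTree p) k) → internalsV v ≡ n → v ∈ forests k n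
forests-complete zero    zero    []      _     = here refl
forests-complete (suc k) n       (t ∷ f) total = withFirstTree-complete (forests k) (forests-complete k) 0 n t f z≤n total

forests-unique : ∀ {p} k n → Unique (forests {p} k n)
forests-unique zero    zero    = [] ∷ []
forests-unique zero    (suc n) = []
forests-unique (suc k) n       = withFirstTree-unique (forests k) (forests-unique k) 0 n

-- Weighted sums of trees and forests

module _ (m : ℕ) (x : ℚ) where

  private
    b = ℕ→ℚ m * x
    M = ℕ→ℚ m

  forestWeight : ∀ {k} → Vec (PTree (suc m)) k → ℚ
  forestWeight v = productℚ (map (hookFactor m x) (hooksV v))

  forestWeight-∷ : ∀ {k} t (f : Vec (PTree (suc m)) k) → forestWeight (t ∷ f) ≡ treeWeight m x t * forestWeight f
  forestWeight-∷ t f = trans (cong productℚ (List.map-++ (hookFactor m x) (hooks t) (hooksV f)))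
                             (productℚ-++ (map (hookFactor m x) (hooks t)) (map (hookFactor m x) (hooksV f)))

  sum-products : ∀ {k} ts (fs : List (Vec (PTree (suc m)) k)) →
    sumℚ (map forestWeight (cartesianProductWith _∷_ ts fs)) ≡ sumℚ (map (treeWeight m x) ts) * sumℚ (map forestWeight fs)
  sum-products []       fs = sym (*-zeroˡ (sumℚ (map forestWeight fs)))
  sum-products (t ∷ ts) fs = begin
    sumℚ (map forestWeight (map (t ∷_) fs List.++ cartesianProductWith _∷_ ts fs))
      ≡⟨ sumℚ-map-++ forestWeight (map (t ∷_) fs) (cartesianProductWith _∷_ ts fs) ⟩
    sumℚ (map forestWeight (map (t ∷_) fs)) + sumℚ (map forestWeight (cartesianProductWith _∷_ ts fs))
      ≡⟨ cong₂ _+_ first-tree-t (sum-products ts fs) ⟩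
    treeWeight m x t * F + sumℚ (map (treeWeight m x) ts) * F
      ≡⟨ *-distribʳ-+ F (treeWeight m x t) (sumℚ (map (treeWeight m x) ts)) ⟨
    (treeWeight m x t + sumℚ (map (treeWeight m x) ts)) * F
      ∎
    where
    open ≡-Reasoning
    F = sumℚ (map forestWeight fs)
    first-tree-t : sumℚ (map forestWeight (map (t ∷_) fs)) ≡ treeWeight m x t * F
    first-tree-t = begin
      sumℚ (map forestWeight (map (t ∷_) fs))                 ≡⟨ cong sumℚ (List.map-∘ fs) ⟨
      sumℚ (map (forestWeight ∘ (t ∷_)) fs)                   ≡⟨ cong sumℚ (List.map-cong (forestWeight-∷ t) fs) ⟩
      sumℚ (map (λ f → treeWeight m x t * forestWeight f) fs) ≡⟨ sumℚ-map-*ˡ (treeWeight m x t) forestWeight fs ⟩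
      treeWeight m x t * F                                    ∎

  treeSum : ℕ → ℚ
  treeSum n = sumℚ (map (treeWeight m x) (trees n))

  forestSum : ℕ → ℕ → ℚ
  forestSum k n = sumℚ (map forestWeight (forests k n))

  sum-withFirstTree : ∀ {k} (G : ℕ → List (Vec (PTree (suc m)) k)) s n →
    sumℚ (map forestWeight (withFirstTree G s n)) ≡ conv (treeSum ∘ (s ℕ.+_)) (λ j → sumℚ (map forestWeight (G j))) n
  sum-withFirstTree G s zero    =
    trans (sum-products (trees s) (G 0)) (cong (λ i → treeSum i * _) (sym (ℕₚ.+-identityʳ s)))
  sum-withFirstTree G s (suc n) = begin
    sumℚ (map forestWeight (first-block List.++ withFirstTree G (suc s) n))
      ≡⟨ sumℚ-map-++ forestWeight first-block (withFirstTree G (suc s) n) ⟩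
    sumℚ (map forestWeight first-block) + sumℚ (map forestWeight (withFirstTree G (suc s) n))
      ≡⟨ cong₂ _+_ (sum-products (trees s) (G (suc n))) (sum-withFirstTree G (suc s) n) ⟩
    treeSum s * Gsum (suc n) + conv (treeSum ∘ (suc s ℕ.+_)) Gsum n
      ≡⟨ cong₂ _+_ (cong (λ i → treeSum i * Gsum (suc n)) (sym (ℕₚ.+-identityʳ s)))
                   (conv-cong n (λ i _ → cong treeSum (sym (ℕₚ.+-suc s i))) (λ _ _ → refl)) ⟩
    conv (treeSum ∘ (s ℕ.+_)) Gsum (suc n)
      ∎
    where
    open ≡-Reasoning
    first-block = cartesianProductWith _∷_ (trees s) (G (suc n))
    Gsum : ℕ → ℚ
    Gsum j = sumℚ (map forestWeight (G j))

  forestSum-zero : ∀ n → forestSum 0 n ≡ δ n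
  forestSum-zero zero    = refl
  forestSum-zero (suc n) = refl

  forestSum-suc : ∀ k n → forestSum (suc k) n ≡ conv treeSum (forestSum k) n
  forestSum-suc k = sum-withFirstTree (forests k) 0

  treeSum-suc : ∀ n → treeSum (suc n) ≡ hookFactor m x (suc n) * forestSum (suc m) n
  treeSum-suc n = begin
    sumℚ (map (treeWeight m x) (map node children))        ≡⟨ cong sumℚ (List.map-∘ children) ⟨
    sumℚ (map (treeWeight m x ∘ node) children)            ≡⟨ cong sumℚ (List.map-cong-local root-hook) ⟩
    sumℚ (map (λ cs → h * forestWeight cs) children)       ≡⟨ sumℚ-map-*ˡ h forestWeight children ⟩
    h * sumℚ (map forestWeight children)                   ≡⟨ cong (h *_) (sum-over-enumeration forestWeight
                                                                (preorderForests-unique (suc m) n) (forests-unique (suc m) n) same-forests) ⟩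
    h * forestSum (suc m) n                                ∎
    where
    open ≡-Reasoning
    children = preorderForests (suc m) n
    h = hookFactor m x (suc n)
    root-hook : All (λ cs → treeWeight m x (node cs) ≡ h * forestWeight cs) children
    root-hook = All.map (λ total → cong (λ i → hookFactor m x (suc i) * _) total) (preorderForests-sound (suc m) n)
    same-forests : ∀ {v} → (v ∈ children) ⇔ (v ∈ forests (suc m) n)
    same-forests {v} = mk⇔ (λ v∈ → forests-complete (suc m) n v (All.lookup (preorderForests-sound (suc m) n) v∈))
                           (λ v∈ → preorderForests-complete (suc m) n v (All.lookup (forests-sound (suc m) n) v∈))

  hookFactor-suc : ∀ n → hookFactor m x (suc n) ≡ (x + b * ℕ→ℚ (suc n) - ℕ→ℚ n) * 1/ℕ (suc m) * 1/ℕ (suc n)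
  hookFactor-suc n = begin
    (ℕ→ℚ (m ℕ.* suc n ℕ.+ 1) * x + 1ℚ - ℕ→ℚ (suc n)) * 1/ℕ (suc m ℕ.* suc n)
      ≡⟨ cong₂ (λ a c → (a * x + 1ℚ - c) * 1/ℕ (suc m ℕ.* suc n)) (trans (ℕ→ℚ-+ (m ℕ.* suc n) 1) (cong (_+ 1ℚ) (ℕ→ℚ-* m (suc n)))) (ℕ→ℚ-suc n) ⟩
    ((M * N + 1ℚ) * x + 1ℚ - (1ℚ + ℕ→ℚ n)) * 1/ℕ (suc m ℕ.* suc n)
      ≡⟨ cong (((M * N + 1ℚ) * x + 1ℚ - (1ℚ + ℕ→ℚ n)) *_) (1/ℕ-* (suc m) (suc n)) ⟩
    ((M * N + 1ℚ) * x + 1ℚ - (1ℚ + ℕ→ℚ n)) * (1/ℕ (suc m) * 1/ℕ (suc n))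
      ≡⟨ solve 6 (λ M N x n i j → ((M :* N :+ con 1ℚ) :* x :+ con 1ℚ :- (con 1ℚ :+ n)) :* (i :* j) := (x :+ M :* x :* N :- n) :* i :* j) refl M N x (ℕ→ℚ n) (1/ℕ (suc m)) (1/ℕ (suc n)) ⟩
    (x + b * N - ℕ→ℚ n) * 1/ℕ (suc m) * 1/ℕ (suc n)
      ∎
    where
    open ≡-Reasoning
    N = ℕ→ℚ (suc n)

  [1+m]*1/[1+m] : (1ℚ + M) * 1/ℕ (suc m) ≡ 1ℚ
  [1+m]*1/[1+m] = trans (cong (_* 1/ℕ (suc m)) (sym (ℕ→ℚ-suc m))) (ℕ→ℚ*1/ℕ (suc m))

  hookFactor-Rothe : ∀ n → hookFactor m x (suc n) * Rothe b n (ℕ→ℚ (suc m) * x) ≡ Rothe b (suc n) x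
  hookFactor-Rothe zero = begin
    hookFactor m x 1 * 1ℚ                     ≡⟨ cong (_* 1ℚ) (hookFactor-suc 0) ⟩
    (x + b * 1ℚ - 0ℚ) * ι * 1ℚ * 1ℚ           ≡⟨ solve 3 (λ x M ι → (x :+ M :* x :* con 1ℚ :- con 0ℚ) :* ι :* con 1ℚ :* con 1ℚ := ((con 1ℚ :+ M) :* ι) :* (x :* con 1ℚ :* con 1ℚ)) refl x M ι ⟩
    ((1ℚ + M) * ι) * (x * 1ℚ * 1ℚ)            ≡⟨ cong (_* (x * 1ℚ * 1ℚ)) [1+m]*1/[1+m] ⟩
    1ℚ * (x * 1ℚ * 1ℚ)                        ≡⟨ *-identityˡ _ ⟩
    Rothe b 1 x                               ∎
    where
    open ≡-Reasoning
    ι = 1/ℕ (suc m)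
  hookFactor-Rothe (suc k) = begin
    hookFactor m x (suc (suc k)) * (ℕ→ℚ (suc m) * x * falling (ℕ→ℚ (suc m) * x + b * K₁ - 1ℚ) k * 1/fact (suc k))
      ≡⟨ cong₂ _*_ (hookFactor-suc (suc k)) (cong₂ (λ a y → a * x * falling y k * 1/fact (suc k)) (ℕ→ℚ-suc m) argument) ⟩
    (x + b * N - K₁) * ι * ι′ * ((1ℚ + M) * x * G * 1/fact (suc k))
      ≡⟨ solve 9 (λ x b N K₁ ι ι′ M G F → (x :+ b :* N :- K₁) :* ι :* ι′ :* ((con 1ℚ :+ M) :* x :* G :* F)
                := ((con 1ℚ :+ M) :* ι) :* (x :* (G :* (x :+ b :* N :- K₁)) :* (ι′ :* F))) refl x b N K₁ ι ι′ M G (1/fact (suc k)) ⟩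
    ((1ℚ + M) * ι) * (x * (G * (x + b * N - K₁)) * (ι′ * 1/fact (suc k)))
      ≡⟨ cong₂ (λ u v → u * (x * (G * v) * (ι′ * 1/fact (suc k)))) [1+m]*1/[1+m] last-factor ⟩
    1ℚ * (x * (G * (Y - ℕ→ℚ k)) * (ι′ * 1/fact (suc k)))
      ≡⟨ cong (λ f → 1ℚ * (x * (G * (Y - ℕ→ℚ k)) * f)) (1/fact-suc (suc k)) ⟨
    1ℚ * (x * (G * (Y - ℕ→ℚ k)) * 1/fact (suc (suc k)))
      ≡⟨ *-identityˡ _ ⟩
    Rothe b (suc (suc k)) x
      ∎
    where
    open ≡-Reasoning
    K₁ = ℕ→ℚ (suc k)
    N = ℕ→ℚ (suc (suc k))
    ι = 1/ℕ (suc m)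
    ι′ = 1/ℕ (suc (suc k))
    Y = x + b * N - 1ℚ
    G = falling Y k
    argument : ℕ→ℚ (suc m) * x + b * K₁ - 1ℚ ≡ Y
    argument = begin
      ℕ→ℚ (suc m) * x + b * K₁ - 1ℚ   ≡⟨ cong (λ a → a * x + b * K₁ - 1ℚ) (ℕ→ℚ-suc m) ⟩
      (1ℚ + M) * x + M * x * K₁ - 1ℚ  ≡⟨ solve 3 (λ M x K → (con 1ℚ :+ M) :* x :+ M :* x :* K :- con 1ℚ := x :+ M :* x :* (con 1ℚ :+ K) :- con 1ℚ) refl M x K₁ ⟩
      x + b * (1ℚ + K₁) - 1ℚ          ≡⟨ cong (λ n → x + b * n - 1ℚ) (ℕ→ℚ-suc (suc k)) ⟨
      Y                               ∎
    last-factor : x + b * N - K₁ ≡ Y - ℕ→ℚ k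
    last-factor = trans (cong (λ t → x + b * N - t) (ℕ→ℚ-suc k))
                        (solve 2 (λ z K → z :- (con 1ℚ :+ K) := z :- con 1ℚ :- K) refl (x + b * N) (ℕ→ℚ k))

  forestSum-Rothe : ∀ N → (∀ j → j ≤ N → treeSum j ≡ Rothe b j x) →
                    ∀ k n → n ≤ N → forestSum k n ≡ Rothe b n (ℕ→ℚ k * x)
  forestSum-Rothe N trees≡ zero n n≤N = trans (forestSum-zero n) (δ≡Rothe n)
    where
    δ≡Rothe : ∀ n → δ n ≡ Rothe b n (0ℚ * x)
    δ≡Rothe zero    = refl
    δ≡Rothe (suc n) = sym (trans (cong (Rothe b (suc n)) (*-zeroˡ x)) (Rothe-at-0 b n))
  forestSum-Rothe N trees≡ (suc k) n n≤N = begin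
    forestSum (suc k) n
      ≡⟨ forestSum-suc k n ⟩
    conv treeSum (forestSum k) n
      ≡⟨ conv-cong n (λ j j≤n → trees≡ j (ℕₚ.≤-trans j≤n n≤N)) (λ j j≤n → forestSum-Rothe N trees≡ k j (ℕₚ.≤-trans j≤n n≤N)) ⟩
    conv (λ j → Rothe b j x) (λ j → Rothe b j (ℕ→ℚ k * x)) n
      ≡⟨ rothe-convolution b n x (ℕ→ℚ k * x) ⟩
    Rothe b n (x + ℕ→ℚ k * x)
      ≡⟨ cong (Rothe b n) (trans (solve 2 (λ x K → x :+ K :* x := (con 1ℚ :+ K) :* x) refl x (ℕ→ℚ k)) (cong (_* x) (sym (ℕ→ℚ-suc k)))) ⟩
    Rothe b n (ℕ→ℚ (suc k) * x)
      ∎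
    where open ≡-Reasoning

  treeSum-Rothe : ∀ n j → j ≤ n → treeSum j ≡ Rothe b j x
  treeSum-Rothe zero    zero    z≤n = refl
  treeSum-Rothe (suc n) j       j≤1+n with ℕₚ.m≤n⇒m<n∨m≡n j≤1+n
  ... | inj₁ (s≤s j≤n) = treeSum-Rothe n j j≤n
  ... | inj₂ refl      = begin
    treeSum (suc n)                                       ≡⟨ treeSum-suc n ⟩
    hookFactor m x (suc n) * forestSum (suc m) n          ≡⟨ cong (hookFactor m x (suc n) *_) (forestSum-Rothe n (treeSum-Rothe n) (suc m) n ℕₚ.≤-refl) ⟩
    hookFactor m x (suc n) * Rothe b n (ℕ→ℚ (suc m) * x)  ≡⟨ hookFactor-Rothe n ⟩
    Rothe b (suc n) x                                     ∎
    where open ≡-Reasoning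

  Rothe-as-binomial : ∀ n → Rothe b n x ≡ ((+ 1) / suc (m ℕ.* n)) * binom (ℕ→ℚ (suc (m ℕ.* n)) * x) n
  Rothe-as-binomial zero    = cong (λ t → 1/ℕ (suc t) * binom (ℕ→ℚ (suc t) * x) 0) (sym (ℕₚ.*-zeroʳ m))
  Rothe-as-binomial (suc k) = sym (begin
    ι * (falling (N * x) (suc k) * 1/fact (suc k))       ≡⟨ cong (λ t → ι * (t * 1/fact (suc k))) (falling-sucˡ (N * x) k) ⟩
    ι * (N * x * falling (N * x - 1ℚ) k * 1/fact (suc k)) ≡⟨ cong (λ t → ι * (N * x * falling t k * 1/fact (suc k))) argument ⟩
    ι * (N * x * G * 1/fact (suc k))                      ≡⟨ solve 5 (λ i N x G J → i :* (N :* x :* G :* J) := (N :* i) :* (x :* G :* J)) refl ι N x G (1/fact (suc k)) ⟩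
    (N * ι) * (x * G * 1/fact (suc k))                    ≡⟨ cong (_* (x * G * 1/fact (suc k))) (ℕ→ℚ*1/ℕ (suc (m ℕ.* suc k))) ⟩
    1ℚ * (x * G * 1/fact (suc k))                         ≡⟨ *-identityˡ _ ⟩
    x * G * 1/fact (suc k)                                ∎)
    where
    open ≡-Reasoning
    ι = 1/ℕ (suc (m ℕ.* suc k))
    N = ℕ→ℚ (suc (m ℕ.* suc k))
    G = falling (x + b * ℕ→ℚ (suc k) - 1ℚ) k
    argument : N * x - 1ℚ ≡ x + b * ℕ→ℚ (suc k) - 1ℚ
    argument = begin
      N * x - 1ℚ                          ≡⟨ cong (λ t → t * x - 1ℚ) (trans (ℕ→ℚ-suc (m ℕ.* suc k)) (cong (_+_ 1ℚ) (ℕ→ℚ-* m (suc k)))) ⟩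
      (1ℚ + M * ℕ→ℚ (suc k)) * x - 1ℚ     ≡⟨ solve 3 (λ M K x → (con 1ℚ :+ M :* K) :* x :- con 1ℚ := x :+ M :* x :* K :- con 1ℚ) refl M (ℕ→ℚ (suc k)) x ⟩
      x + b * ℕ→ℚ (suc k) - 1ℚ            ∎

theorem3p1 : (m n : ℕ) (x : ℚ)
    → (L : List (PTree (suc m)))
    → (∀ T → (T ∈ L) ⇔ (internals T ≡ n))
    → Unique L
    → sumℚ (map (treeWeight m x) L)
      ≡ ((+ 1) / suc (m ℕ.* n)) * binom (ℕ→ℚ (suc (m ℕ.* n)) * x) n
theorem3p1 m n x L L-enumerates L-unique = begin
  sumℚ (map (treeWeight m x) L)   ≡⟨ sum-over-enumeration (treeWeight m x) L-unique (trees-unique n) same-trees ⟩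
  treeSum m x n                   ≡⟨ treeSum-Rothe m x n n ℕₚ.≤-refl ⟩
  Rothe (ℕ→ℚ m * x) n x           ≡⟨ Rothe-as-binomial m x n ⟩
  ((+ 1) / suc (m ℕ.* n)) * binom (ℕ→ℚ (suc (m ℕ.* n)) * x) n ∎
  where
  open ≡-Reasoning
  same-trees : ∀ {T} → (T ∈ L) ⇔ (T ∈ trees n)
  same-trees {T} = mk⇔ (λ T∈L → trees-complete n T (Equivalence.to (L-enumerates T) T∈L))
                       (λ T∈ → Equivalence.from (L-enumerates T) (All.lookup (trees-sound n) T∈))
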